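{- For every positive integer $n$ there exists a bijection $\phi\colon \mathrm{zRTT}_0(n)\to \mathrm{zLD}^2(n)$ such that for every $T\in\mathrm{zRTT}_0(n)$ we have $\alpha(\phi(T))=\alpha(T)$ and $\beta(\phi(T))=\mathrm{rev}(\beta(T))$.
   Context: A tiered rooted tree on $n+1$ vertices is a tree $T$ with vertex set $V$, $|V|=n+1$, a distinguished root $r\in V$, and two functions $w$ (label) and $\mathrm{lv}$ (level) on $V$ with $w(r)=\mathrm{lv}(r)=0$ and $w(v),\mathrm{lv}(v)\in\mathbb{Z}_{\ge 1}$ for $v\neq r$, such that: (1) for every edge $\{u,v\}$ with $u,v\neq r$ we have $w(u)\neq w(v)$, $\mathrm{lv}(u)\ne\mathrm{lv}(v)$, and $w(u)<w(v)\iff \mathrm{lv}(u)<\mathrm{lv}(v)$; (2) any two distinct vertices with the same parent have different pairs $(w,\mathrm{lv})$. (Edges incident to the root are unconstrained.) Trees are considered up to isomorphism preserving root, labels and levels. The parent $p(v)$ of $v\neq r$ is its neighbour closer to $r$; $u$ is a descendant of $v$ (and $v$ an ancestor of $u$) if $v=p^k(u)$ for some $k>0$. Two vertices $u,v$ are compatible, written $u\bowtie v$, if either ($\mathrm{lv}(u)<\mathrm{lv}(v)$ and $w(u)<w(v)$) or ($\mathrm{lv}(u)>\mathrm{lv}(v)$ and $w(u)>w(v)$). A pair $(u,v)$ of non-root vertices is an inversion if $v$ is a descendant of $u$, $v\bowtie p(u)$, and either $w(v)<w(u)$ or ($w(v)=w(u)$ and $\mathrm{lv}(v)>\mathrm{lv}(u)$).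 $\mathrm{zRTT}_0(n)$ is the set of tiered rooted trees on $n+1$ vertices with no inversions. For such $T$, $\alpha(T)$ (resp. $\beta(T)$) is the weak composition whose $i$-th entry ($i\ge1$) is the number of non-root vertices with label $i$ (resp. level $i$). $\mathrm{zLD}^2(n)$ is the set of pairs of sequences $(a,b)$ with $a=(a_1,\dots,a_n)$, $b=(b_1,\dots,b_n)$ of positive integers such that for each $1\le i\le n-1$, $a_i<a_{i+1}$ or $b_i<b_{i+1}$ (these are exactly the $2$-labelled Dyck paths of size $n$ with area $0$). For $(a,b)\in\mathrm{zLD}^2(n)$, $\alpha(a,b)_i=\#\{j: a_j=i\}$ and $\beta(a,b)_i=\#\{j:b_j=i\}$. For a weak composition $\beta$ with some nonzero entry, let $s$ be the smallest and $m$ the largest index with $\beta_s\ne0$, $\beta_m\neq 0$; $\mathrm{rev}(\beta)$ is the weak composition with $\mathrm{rev}(\beta)_i=\beta_{s+m-i}$ for $s\le i\le m$ and $0$ otherwise. -}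

module Defs where

open import Data.Nat using (ℕ; zero; suc; _+_; _∸_; _≤_; _<_; _>_; _≟_; _≤?_)
open import Data.Product using (Σ; _×_; _,_; proj₁; proj₂)
open import Data.Sum using (_⊎_)
open import Data.List using (List; []; _∷_; _++_; map; concatMap; length)
open import Data.List.Relation.Unary.All using (All)
open import Data.List.Relation.Unary.Linked using (Linked)
open import Data.Vec using (Vec; toList; zip)
open import Relation.Binary.PropositionalEquality using (_≡_; _≢_)
import Relation.Binary.PropositionalEquality as ≡
open import Relation.Binary.Bundles using (Setoid)
import Relation.Binary.Construct.On as On
open import Relation.Nullary using (¬_; yes; no)
open import Relation.Nullary.Decidable using (⌊_⌋)
open import Data.Bool using (if_then_else_; _∧_)
open import Function.Base using (_∘_)

occ : ℕ → List ℕ → ℕ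
occ i []       = 0
occ i (x ∷ xs) with x ≟ i
... | yes _ = suc (occ i xs)
... | no  _ = occ i xs

-- A vertex datum: (label w , level lv).  The root has datum (0 , 0).
Datum : Set
Datum = ℕ × ℕ

wOf lvOf : Datum → ℕ
wOf  = proj₁
lvOf = proj₂

_⋈_ : Datum → Datum → Set
u ⋈ v = (lvOf u < lvOf v × wOf u < wOf v) ⊎ (lvOf u > lvOf v × wOf u > wOf v)

-- strict lexicographic order on data; used to list siblings canonically
_<lex_ : Datum → Datum → Set
u <lex v = wOf u < wOf v ⊎ (wOf u ≡ wOf v × lvOf u < lvOf v)

-- Rooted trees.  A non-root vertex is `node w lv children`; a rooted tree
-- is represented by the list (forest) of the subtrees hanging from the root.

data Tree : Set where
  node : ℕ → ℕ → List Tree → Tree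

datum : Tree → Datum
datum (node w l _) = w , l

mutual
  verts : Tree → List Datum
  verts (node w l cs) = (w , l) ∷ vertsF cs

  vertsF : List Tree → List Datum
  vertsF []       = []
  vertsF (t ∷ ts) = verts t ++ vertsF ts

descendants : Tree → List Datum
descendants (node _ _ cs) = vertsF cs

-- (u , v) with v a descendant of u is an inversion, given the datum p of p(u)
Inversion : (p u v : Datum) → Set
Inversion p u v = (v ⋈ p) × (wOf v < wOf u ⊎ (wOf v ≡ wOf u × lvOf v > lvOf u))

EdgeOK : Datum → Datum → Set
EdgeOK u v = wOf u ≢ wOf v × lvOf u ≢ lvOf v
           × ((wOf u < wOf v → lvOf u < lvOf v) × (lvOf u < lvOf v → wOf u < wOf v))

-- Good p t : the subtree t, whose top vertex has parent with datum p, satisfies: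
--   labels/levels ≥ 1, condition (1) on edges to its children, condition (2)
--   via children listed in strictly increasing (w , lv) order (this also makes
--   the representation canonical up to isomorphism), and no inversion (u , v)
--   with u the top vertex; recursively for all children.
data Good (p : Datum) : Tree → Set where
  good : ∀ {w l cs} →
         1 ≤ w → 1 ≤ l →
         All (λ c → EdgeOK (w , l) (datum c)) cs →
         Linked _<lex_ (map datum cs) →
         All (λ v → ¬ Inversion p (w , l) v) (vertsF cs) →
         All (Good (w , l)) cs →
         Good p (node w l cs)

-- a tiered rooted tree without inversions, given by the forest under the root
-- (root datum (0 , 0); edges at the root unconstrained)
GoodRooted : List Tree → Set
GoodRooted ts = Linked _<lex_ (map datum ts) × All (Good (0 , 0)) ts

ZRTT₀ : ℕ → Set
ZRTT₀ n = Σ (List Tree) λ ts → length (vertsF ts) ≡ n × GoodRooted ts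

-- trees are compared by their (canonical) underlying data only
ZRTT₀-setoid : ℕ → Setoid _ _
ZRTT₀-setoid n = On.setoid (≡.setoid (List Tree)) (proj₁ {B = λ ts → length (vertsF ts) ≡ n × GoodRooted ts})

αT βT : ∀ {n} → ZRTT₀ n → ℕ → ℕ
αT (ts , _) i = occ i (map wOf  (vertsF ts))
βT (ts , _) i = occ i (map lvOf (vertsF ts))

Step : Datum → Datum → Set
Step (a , b) (a' , b') = a < a' ⊎ b < b'

ZLD² : ℕ → Set
ZLD² n = Σ (Vec ℕ n × Vec ℕ n) λ ab →
           All (1 ≤_) (toList (proj₁ ab)) × All (1 ≤_) (toList (proj₂ ab))
           × Linked Step (toList (zip (proj₁ ab) (proj₂ ab)))

ZLD²-setoid : ℕ → Setoid _ _
ZLD²-setoid n = On.setoid (≡.setoid (Vec ℕ n × Vec ℕ n)) (proj₁ {B = λ ab → All (1 ≤_) (toList (proj₁ ab)) × All (1 ≤_) (toList (proj₂ ab)) × Linked Step (toList (zip (proj₁ ab) (proj₂ ab)))})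

αD βD : ∀ {n} → ZLD² n → ℕ → ℕ
αD ((a , b) , _) i = occ i (toList a)
βD ((a , b) , _) i = occ i (toList b)

-- Weak compositions are functions ℕ → ℕ, entries at indices i ≥ 1.

IsMinSupp : (ℕ → ℕ) → ℕ → Set
IsMinSupp β s = 1 ≤ s × β s ≢ 0 × (∀ i → 1 ≤ i → i < s → β i ≡ 0)

IsMaxSupp : (ℕ → ℕ) → ℕ → Set
IsMaxSupp β m = 1 ≤ m × β m ≢ 0 × (∀ i → m < i → β i ≡ 0)

revAt : (ℕ → ℕ) → ℕ → ℕ → ℕ → ℕ
revAt β s m i = if ⌊ s ≤? i ⌋ ∧ ⌊ i ≤? m ⌋ then β ((s + m) ∸ i) else 0

IsRev : (β γ : ℕ → ℕ) → Set
IsRev β γ = ∀ s m → IsMinSupp β s → IsMaxSupp β m →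
            ∀ i → 1 ≤ i → γ i ≡ revAt β s m i

-- Sort the children of every vertex by ≺ (increasing label, and decreasing level among equal labels)
-- instead of lexicographically, and read the resulting forest in postorder. At every step of this word
-- the label rises or the level falls: the absence of inversions propagates down the tree the invariant
-- that a descendant of p which ≺-precedes p lies strictly south-west of p (Guarded). Conversely the
-- forest is recovered from the word: the root c of the first tree is the unique vertex compatible with
-- the parent such that no earlier compatible vertex ≺-precedes c and every later one follows it, and
-- one recurses on the two sides of c. Finally, reflecting each level b to lo + hi − b, where lo and hi are
-- the extreme levels, turns "the level falls" into "the level rises", keeps the labels and reverses the
-- level composition.

{-# OPTIONS --safe #-}
module Submission where

open import Defs
open import Data.Bool using (if_then_else_; _∧_)
open import Data.List as List using (List; []; _∷_; _++_; [_]; _∷ʳ_; map; length; filter)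
open import Data.List.Extrema.Nat
  using (min; max; argmin-sel; argmax-sel; min≤⊤; min≤xs; ⊥≤max; xs≤max; min≤v⁺; v≤min⁺; max≤v⁺; v≤max⁺)
open import Data.List.Membership.Propositional using (_∈_)
open import Data.List.Membership.Propositional.Properties using (∈-map⁺)
open import Data.List.Properties
  using (++-assoc; ∷-injective; ++-conicalʳ; ∷ʳ-++; length-map; filter-accept; filter-reject; map-∘; map-id-local)
import Data.List.Relation.Binary.Permutation.Propositional as ↭
open import Data.List.Relation.Binary.Permutation.Propositional
  using (_↭_; ↭-sym; ↭-trans; module PermutationReasoning)
open import Data.List.Relation.Binary.Permutation.Propositional.Properties
  using (All-resp-↭; ∈-resp-↭; ↭-empty-inv; drop-∷; ++⁺; ++⁺ˡ; shift; shifts; filter-↭; ↭-length)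
import Data.List.Relation.Binary.Permutation.Propositional.Properties as Perm
open import Data.List.Relation.Unary.All as All using (All; []; _∷_)
import Data.List.Relation.Unary.All.Properties as Allₚ
open import Data.List.Relation.Unary.AllPairs as AllPairs using (AllPairs; []; _∷_)
open import Data.List.Relation.Unary.Any as Any using (Any; here; there)
open import Data.List.Relation.Unary.Linked as Linked using (Linked; []; [-]; _∷_)
import Data.List.Relation.Unary.Linked.Properties as Linkedₚ
open import Data.Nat using (ℕ; zero; suc; _+_; _∸_; _≤_; _<_; _≟_; _≤?_; _<?_; z≤n; s≤s)
open import Data.Nat.Induction using (<-wellFounded)
open import Data.Nat.Properties
  using ( <-strictTotalOrder; <-cmp; <-irrefl; <-asym; ≮⇒≥; <-≤-trans; ≤-<-trans; ≤-trans; ≤-antisym; ≤-reflexive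
        ; n<1+n; m<n⇒m<1+n; m≤n+m; m+n∸n≡m; m+n∸m≡n; m∸[m∸n]≡n; ∸-monoʳ-≤; ∸-monoʳ-<)
open import Data.Product using (Σ; Σ-syntax; _×_; _,_; proj₁; proj₂; map₂)
open import Data.Product.Relation.Binary.Lex.Strict using (×-strictTotalOrder)
open import Data.Sum using (_⊎_; inj₁; inj₂)
open import Data.Vec as Vec using (Vec; []; _∷_; toList; zip)
open import Data.Vec.Properties using (toList-map; map-proj₁-zip; map-proj₂-zip; length-toList)
open import Function.Base using (id; _∘_)
open import Function.Bundles using (Bijection)
open import Induction.WellFounded using (Acc; acc)
open import Level using (_⊔_)
open import Relation.Binary.Bundles using (StrictTotalOrder; DecTotalOrder)
import Relation.Binary.Construct.Flip.EqAndOrd as Flip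
import Relation.Binary.Construct.On as On
open import Relation.Binary.Core using (Rel)
open import Relation.Binary.Definitions using (Symmetric; tri<; tri≈; tri>)
import Relation.Binary.Properties.StrictTotalOrder as StrictTotalOrderₚ
open import Relation.Binary.PropositionalEquality
  using (_≡_; _≢_; refl; sym; trans; cong; cong₂; subst; module ≡-Reasoning)
open import Relation.Binary.Structures using (IsStrictTotalOrder)
open import Relation.Nullary using (¬_; Dec; yes; no; contradiction)
open import Relation.Nullary.Decidable using (⌊_⌋; _×-dec_; _⊎-dec_)

<lex-strictTotalOrder : StrictTotalOrder _ _ _
<lex-strictTotalOrder = ×-strictTotalOrder <-strictTotalOrder <-strictTotalOrder

-- With this order, Inversion p u v is definitionally v ⋈ p × v ≺ u.
≺-strictTotalOrder : StrictTotalOrder _ _ _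
≺-strictTotalOrder = ×-strictTotalOrder <-strictTotalOrder (Flip.strictTotalOrder <-strictTotalOrder)

open StrictTotalOrder ≺-strictTotalOrder public
  using () renaming (_<_ to _≺_; _<?_ to _≺?_; trans to ≺-trans; compare to ≺-compare)

≺-≮-trans : ∀ {u v x} → u ≺ v → ¬ x ≺ v → u ≺ x
≺-≮-trans {v = v} {x} u≺v x⊀v with ≺-compare x v
... | tri< x≺v _ _         = contradiction x≺v x⊀v
... | tri≈ _ (refl , refl) _ = u≺v
... | tri> _ _ v≺x         = ≺-trans u≺v v≺x

AllPairs-resp-↭ : ∀ {a r} {A : Set a} {R : A → A → Set r} → Symmetric R →
                  ∀ {xs ys} → xs ↭ ys → AllPairs R xs → AllPairs R ys
AllPairs-resp-↭ R-sym ↭.refl         rs                     = rs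
AllPairs-resp-↭ R-sym (↭.prep x p)   (rx ∷ rs)              = All-resp-↭ p rx ∷ AllPairs-resp-↭ R-sym p rs
AllPairs-resp-↭ R-sym (↭.swap x y p) ((rxy ∷ rx) ∷ ry ∷ rs) =
  (R-sym rxy ∷ All-resp-↭ p ry) ∷ All-resp-↭ p rx ∷ AllPairs-resp-↭ R-sym p rs
AllPairs-resp-↭ R-sym (↭.trans p q)  rs                     = AllPairs-resp-↭ R-sym q (AllPairs-resp-↭ R-sym p rs)

module _ {A : Set} {R : A → A → Set} where

  Linked-∷⁺ : ∀ {x ys} → All (R x) ys → Linked R ys → Linked R (x ∷ ys)
  Linked-∷⁺ []      _  = [-]
  Linked-∷⁺ (r ∷ _) ls = r ∷ ls

  Linked-∷ʳ⁺ : ∀ {x xs} → Linked R xs → All (λ y → R y x) xs → Linked R (xs ∷ʳ x)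
  Linked-∷ʳ⁺ []         []           = [-]
  Linked-∷ʳ⁺ [-]        (r ∷ [])     = r ∷ [-]
  Linked-∷ʳ⁺ (r ∷ ls)   (_ ∷ rs)     = r ∷ Linked-∷ʳ⁺ ls rs

  Linked-join : ∀ xs {x ys} → Linked R (xs ∷ʳ x) → All (R x) ys → Linked R ys → Linked R (xs ++ x ∷ ys)
  Linked-join []           _        rs ls = Linked-∷⁺ rs ls
  Linked-join (_ ∷ [])     (r ∷ _)  rs ls = r ∷ Linked-∷⁺ rs ls
  Linked-join (_ ∷ y ∷ xs) (r ∷ l)  rs ls = r ∷ Linked-join (y ∷ xs) l rs ls

  Linked-++⁻ˡ : ∀ xs {ys} → Linked R (xs ++ ys) → Linked R xs
  Linked-++⁻ˡ []           _       = []
  Linked-++⁻ˡ (_ ∷ [])     _       = [-]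
  Linked-++⁻ˡ (_ ∷ y ∷ xs) (r ∷ l) = r ∷ Linked-++⁻ˡ (y ∷ xs) l

  Linked-++⁻ʳ : ∀ xs {ys} → Linked R (xs ++ ys) → Linked R ys
  Linked-++⁻ʳ []       l = l
  Linked-++⁻ʳ (_ ∷ xs) l = Linked-++⁻ʳ xs (Linked.tail l)

Linked-map-local : ∀ {A B : Set} {P : A → Set} {R : A → A → Set} {S : B → B → Set} {f : A → B} →
              (∀ {x y} → P x → P y → R x y → S (f x) (f y)) →
              ∀ {xs} → All P xs → Linked R xs → Linked S (map f xs)
Linked-map-local g []           []       = []
Linked-map-local g (_ ∷ [])     [-]      = [-]
Linked-map-local g (p ∷ q ∷ ps) (r ∷ rs) = g p q r ∷ Linked-map-local g (q ∷ ps) rs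

length-before< : ∀ {A : Set} (xs : List A) {x ys} → length xs < length (xs ++ x ∷ ys)
length-before< []       = s≤s z≤n
length-before< (_ ∷ xs) = s≤s (length-before< xs)

length-after< : ∀ {A : Set} (xs : List A) {x ys} → length ys < length (xs ++ x ∷ ys)
length-after< []       = n<1+n _
length-after< (_ ∷ xs) = m<n⇒m<1+n (length-after< xs)

module SortBy {a ℓ₁ ℓ₂} (S : StrictTotalOrder a ℓ₁ ℓ₂) {X : Set} (key : X → StrictTotalOrder.Carrier S)
  where

  open StrictTotalOrder S using (_≈_; module Eq; irrefl; asym) renaming (_<_ to _⊏_; trans to ⊏-trans)

  Sorted : List X → Set _
  Sorted xs = Linked _⊏_ (map key xs)

  Distinct : List X → Set _
  Distinct xs = AllPairs (λ k k′ → ¬ k ≈ k′) (map key xs)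

  private
    keyOrder : DecTotalOrder _ _ _
    keyOrder = On.decTotalOrder (StrictTotalOrderₚ.decTotalOrder S) key

  open import Data.List.Sort keyOrder public using (sort; sort-↭)
  open import Data.List.Sort keyOrder using (sort-↗)

  sorted⇒distinct : ∀ {xs} → Sorted xs → Distinct xs
  sorted⇒distinct s = AllPairs.map (λ k⊏k′ k≈k′ → irrefl k≈k′ k⊏k′) (Linkedₚ.Linked⇒AllPairs ⊏-trans s)

  distinct-↭ : ∀ {xs ys} → xs ↭ ys → Distinct xs → Distinct ys
  distinct-↭ p = AllPairs-resp-↭ (λ k≉k′ k′≈k → k≉k′ (Eq.sym k′≈k)) (Perm.map⁺ key p)

  private
    strictify : ∀ {ks} → Linked (λ k k′ → k ⊏ k′ ⊎ k ≈ k′) ks → AllPairs (λ k k′ → ¬ k ≈ k′) ks →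
                Linked _⊏_ ks
    strictify []               _                = []
    strictify [-]              _                = [-]
    strictify (inj₁ k⊏k′ ∷ ls) (_ ∷ ds)         = k⊏k′ ∷ strictify ls ds
    strictify (inj₂ k≈k′ ∷ _)  ((k≉k′ ∷ _) ∷ _) = contradiction k≈k′ k≉k′

  sort-sorted : ∀ {xs} → Distinct xs → Sorted (sort xs)
  sort-sorted {xs} d = strictify (Linkedₚ.map⁺ (sort-↗ xs)) (distinct-↭ (↭-sym (sort-↭ xs)) d)

  sorted-↭⇒≡ : ∀ {xs ys} → Sorted xs → Sorted ys → xs ↭ ys → xs ≡ ys
  sorted-↭⇒≡ {[]}     {[]}     _  _  _ = refl
  sorted-↭⇒≡ {[]}     {y ∷ ys} _  _  p = contradiction (↭-empty-inv (↭-sym p)) λ ()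
  sorted-↭⇒≡ {x ∷ xs} {[]}     _  _  p = contradiction (↭-empty-inv p) λ ()
  sorted-↭⇒≡ {x ∷ xs} {y ∷ ys} sx sy p
    with ∈-resp-↭ p (here refl) | ∈-resp-↭ (↭-sym p) (here refl)
  ... | here refl  | _          = cong (x ∷_) (sorted-↭⇒≡ (Linked.tail sx) (Linked.tail sy) (drop-∷ p))
  ... | there _    | here refl  = cong (x ∷_) (sorted-↭⇒≡ (Linked.tail sx) (Linked.tail sy) (drop-∷ p))
  ... | there x∈ys | there y∈xs = contradiction (later sy x∈ys) (asym (later sx y∈xs))
    where
    later : ∀ {z zs w} → Sorted (z ∷ zs) → w ∈ zs → key z ⊏ key w
    later s w∈zs with Linkedₚ.Linked⇒AllPairs ⊏-trans s
    ... | z⊏zs ∷ _ = All.lookup z⊏zs (∈-map⁺ key w∈zs)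

postF : List Tree → List Datum
postF []                 = []
postF (node w l cs ∷ ts) = postF cs ++ (w , l) ∷ postF ts

postF-↭-vertsF : ∀ ts → postF ts ↭ vertsF ts
postF-↭-vertsF []                 = ↭.refl
postF-↭-vertsF (node w l cs ∷ ts) =
  ↭-trans (shift (w , l) (postF cs) (postF ts))
          (↭.prep (w , l) (++⁺ (postF-↭-vertsF cs) (postF-↭-vertsF ts)))

vertsF-↭ : ∀ {ts ts′} → ts ↭ ts′ → vertsF ts ↭ vertsF ts′
vertsF-↭ ↭.refl          = ↭.refl
vertsF-↭ (↭.prep t p)    = ++⁺ˡ (verts t) (vertsF-↭ p)
vertsF-↭ (↭.swap t t′ p) =
  ↭-trans (shifts (verts t) (verts t′)) (++⁺ˡ (verts t′) (++⁺ˡ (verts t) (vertsF-↭ p)))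
vertsF-↭ (↭.trans p q)   = ↭-trans (vertsF-↭ p) (vertsF-↭ q)

module Resort {ℓ₁ ℓ₂} {_≈_ : Rel Datum ℓ₁} {_<_ : Rel Datum ℓ₂} (isSTO : IsStrictTotalOrder _≈_ _<_)
  where

  private
    strictTotalOrder : StrictTotalOrder _ _ _
    strictTotalOrder = record { isStrictTotalOrder = isSTO }

  open SortBy strictTotalOrder datum public

  mutual
    resort : Tree → Tree
    resort (node w l cs) = node w l (resortForest cs)

    resortForest : List Tree → List Tree
    resortForest cs = sort (resortAll cs)

    resortAll : List Tree → List Tree
    resortAll []       = []
    resortAll (t ∷ ts) = resort t ∷ resortAll ts

  data SortedTree : Tree → Set (ℓ₁ ⊔ ℓ₂) where
    node : ∀ {w l cs} → Sorted cs → All SortedTree cs → SortedTree (node w l cs)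

  resortAll≡map : ∀ ts → resortAll ts ≡ map resort ts
  resortAll≡map []       = refl
  resortAll≡map (t ∷ ts) = cong (resort t ∷_) (resortAll≡map ts)

  map-datum-resortAll : ∀ ts → map datum (resortAll ts) ≡ map datum ts
  map-datum-resortAll []                 = refl
  map-datum-resortAll (node w l _ ∷ ts) = cong ((w , l) ∷_) (map-datum-resortAll ts)

  mutual
    vertsF-resortForest : ∀ ts → vertsF (resortForest ts) ↭ vertsF ts
    vertsF-resortForest ts = ↭-trans (vertsF-↭ (sort-↭ (resortAll ts))) (vertsF-resortAll ts)

    vertsF-resortAll : ∀ ts → vertsF (resortAll ts) ↭ vertsF ts
    vertsF-resortAll []                 = ↭.refl
    vertsF-resortAll (node w l cs ∷ ts) = ++⁺ (↭.prep (w , l) (vertsF-resortForest cs)) (vertsF-resortAll ts)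

  postF-resortForest : ∀ ts → postF (resortForest ts) ↭ vertsF ts
  postF-resortForest ts = ↭-trans (postF-↭-vertsF (resortForest ts)) (vertsF-resortForest ts)

  resortForest-sorted : ∀ {ts} → Distinct ts → Sorted (resortForest ts)
  resortForest-sorted {ts} d = sort-sorted (subst (AllPairs _) (sym (map-datum-resortAll ts)) d)

module ResortInverse
  {ℓ₁ ℓ₂ ℓ₃ ℓ₄} {_≈₁_ : Rel Datum ℓ₁} {_<₁_ : Rel Datum ℓ₂} {_≈₂_ : Rel Datum ℓ₃} {_<₂_ : Rel Datum ℓ₄}
  (isS : IsStrictTotalOrder _≈₁_ _<₁_) (isT : IsStrictTotalOrder _≈₂_ _<₂_) where

  private
    module S = Resort isS
    module T = Resort isT

  mutual
    resort-inverse : ∀ {t} → S.SortedTree t → S.resort (T.resort t) ≡ t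
    resort-inverse (S.node s hs) = cong (node _ _) (resortForest-inverse s hs)

    resortForest-inverse : ∀ {ts} → S.Sorted ts → All S.SortedTree ts →
                           S.resortForest (T.resortForest ts) ≡ ts
    resortForest-inverse {ts} s hs = S.sorted-↭⇒≡ (S.resortForest-sorted distinct) s permutation
      where
      distinct : S.Distinct (T.resortForest ts)
      distinct = S.distinct-↭ (↭-sym (T.sort-↭ (T.resortAll ts)))
                   (subst (AllPairs _) (sym (T.map-datum-resortAll ts)) (S.sorted⇒distinct s))
      open PermutationReasoning
      permutation : S.resortForest (T.resortForest ts) ↭ ts
      permutation = begin
        S.sort (S.resortAll (T.sort (T.resortAll ts)))  ↭⟨ S.sort-↭ _ ⟩
        S.resortAll (T.sort (T.resortAll ts))           ≡⟨ S.resortAll≡map _ ⟩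
        map S.resort (T.sort (T.resortAll ts))          ↭⟨ Perm.map⁺ S.resort (T.sort-↭ (T.resortAll ts)) ⟩
        map S.resort (T.resortAll ts)                   ≡⟨ sym (S.resortAll≡map _) ⟩
        S.resortAll (T.resortAll ts)                    ≡⟨ resortAll-inverse hs ⟩
        ts                                              ∎

    resortAll-inverse : ∀ {ts} → All S.SortedTree ts → S.resortAll (T.resortAll ts) ≡ ts
    resortAll-inverse []       = refl
    resortAll-inverse (h ∷ hs) = cong₂ _∷_ (resort-inverse h) (resortAll-inverse hs)

module SortLex = Resort (StrictTotalOrder.isStrictTotalOrder <lex-strictTotalOrder)
module Sort≺ = Resort (StrictTotalOrder.isStrictTotalOrder ≺-strictTotalOrder)

Pos : Datum → Set
Pos v = 1 ≤ wOf v × 1 ≤ lvOf v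

SouthWest : Datum → Datum → Set
SouthWest v u = wOf v < wOf u × lvOf v < lvOf u

Step↓ : Datum → Datum → Set
Step↓ x y = wOf x < wOf y ⊎ lvOf y < lvOf x

Guarded : Datum → Datum → Set
Guarded p v = v ≺ p → SouthWest v p

_⋈?_ : ∀ u v → Dec (u ⋈ v)
(wu , lu) ⋈? (wv , lv) = ((lu <? lv) ×-dec (wu <? wv)) ⊎-dec ((lv <? lu) ×-dec (wv <? wu))

EdgeOK⇒⋈ : ∀ {u v} → EdgeOK u v → v ⋈ u
EdgeOK⇒⋈ {wu , lu} {wv , lv} (w≢ , l≢ , w<⇒l< , l<⇒w<) with <-cmp wu wv
... | tri< wu<wv _ _ = inj₂ (w<⇒l< wu<wv , wu<wv)
... | tri≈ _ w≡ _    = contradiction w≡ w≢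
... | tri> _ _ wv<wu with <-cmp lu lv
...   | tri< lu<lv _ _ = contradiction (l<⇒w< lu<lv) (<-asym wv<wu)
...   | tri≈ _ l≡ _    = contradiction l≡ l≢
...   | tri> _ _ lv<lu = inj₁ (lv<lu , wv<wu)

⋈⇒EdgeOK : ∀ {u v} → v ⋈ u → EdgeOK u v
⋈⇒EdgeOK (inj₁ (lv<lu , wv<wu)) =
  (λ w≡ → <-irrefl (sym w≡) wv<wu) , (λ l≡ → <-irrefl (sym l≡) lv<lu) ,
  (λ wu<wv → contradiction wv<wu (<-asym wu<wv)) , (λ lu<lv → contradiction lv<lu (<-asym lu<lv))
⋈⇒EdgeOK (inj₂ (lu<lv , wu<wv)) =
  (λ w≡ → <-irrefl w≡ wu<wv) , (λ l≡ → <-irrefl l≡ lu<lv) , (λ _ → lu<lv) , (λ _ → wu<wv)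

⋈⇒Step↓ : ∀ {d c} → d ⋈ c → Step↓ d c
⋈⇒Step↓ (inj₁ (_ , wd<wc)) = inj₁ wd<wc
⋈⇒Step↓ (inj₂ (lc<ld , _)) = inj₂ lc<ld

SouthWest⇒⋈ : ∀ {v u} → SouthWest v u → v ⋈ u
SouthWest⇒⋈ (w< , l<) = inj₁ (l< , w<)

guarded-root : ∀ {v} → 1 ≤ wOf v → Guarded (0 , 0) v
guarded-root _ (inj₁ ())
guarded-root 1≤w (inj₂ (w≡0 , _)) = contradiction (subst (1 ≤_) w≡0 1≤w) λ ()

guarded-¬⋈ : ∀ {p v} → Guarded p v → ¬ v ⋈ p → wOf p ≤ wOf v × lvOf v ≤ lvOf p
guarded-¬⋈ {wp , lp} {wv , lv} guarded v⋈̸p = ≮⇒≥ (λ wv<wp → v⊀p (inj₁ wv<wp)) , ≮⇒≥ lp≮lv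
  where
  v⊀p : ¬ (wv , lv) ≺ (wp , lp)
  v⊀p v≺p = v⋈̸p (SouthWest⇒⋈ (guarded v≺p))
  lp≮lv : ¬ lp < lv
  lp≮lv lp<lv with <-cmp wv wp
  ... | tri< wv<wp _ _ = v⊀p (inj₁ wv<wp)
  ... | tri≈ _ w≡ _    = v⊀p (inj₂ (w≡ , lp<lv))
  ... | tri> _ _ wp<wv = v⋈̸p (inj₂ (lp<lv , wp<wv))

guarded-child : ∀ {p u v} → u ⋈ p → ¬ Inversion p u v → Guarded p v → Guarded u v
guarded-child {p} {u} {v} u⋈p no-inv guarded v≺u
  with guarded-¬⋈ guarded (λ v⋈p → no-inv (v⋈p , v≺u)) | u⋈p
... | wp≤wv , _ | inj₁ (_ , wu<wp) = contradiction (<-≤-trans wu<wp wp≤wv) (wv≮wu v≺u)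
  where
  wv≮wu : v ≺ u → ¬ wOf u < wOf v
  wv≮wu (inj₁ wv<wu)     = <-asym wv<wu
  wv≮wu (inj₂ (w≡ , _)) = <-irrefl (sym w≡)
... | _ , lv≤lp | inj₂ (lp<lu , _) = wv<wu v≺u , lv<lu
  where
  lv<lu = ≤-<-trans lv≤lp lp<lu
  wv<wu : v ≺ u → wOf v < wOf u
  wv<wu (inj₁ wv<wu)       = wv<wu
  wv<wu (inj₂ (_ , lu<lv)) = contradiction lu<lv (<-asym lv<lu)

guarded-step : ∀ {p x v} → x ⋈ p → (v ⋈ p → x ≺ v) → Guarded p v → Step↓ x v
guarded-step {p} {wx , lx} {wv , lv} x⋈p above guarded with wx <? wv | lv <? lx
... | yes wx<wv | _         = inj₁ wx<wv
... | no _      | yes lv<lx = inj₂ lv<lx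
... | no wx≮wv  | no lv≮lx  =
  contradiction x⋈p (x⋈̸p (guarded-¬⋈ guarded (λ v⋈p → x⊀v (above v⋈p))))
  where
  x⊀v : ¬ (wx , lx) ≺ (wv , lv)
  x⊀v (inj₁ wx<wv)       = wx≮wv wx<wv
  x⊀v (inj₂ (_ , lv<lx)) = lv≮lx lv<lx
  x⋈̸p : wOf p ≤ wv × lv ≤ lvOf p → ¬ (wx , lx) ⋈ p
  x⋈̸p (wp≤wv , _) (inj₁ (_ , wx<wp)) = wx≮wv (<-≤-trans wx<wp wp≤wv)
  x⋈̸p (_ , lv≤lp) (inj₂ (lp<lx , _)) = lv≮lx (≤-<-trans lv≤lp lp<lx)

guarded-⋈ : ∀ {y c} → Step↓ y c → Guarded c y → y ⋈ c
guarded-⋈ (inj₁ wy<wc) guarded = SouthWest⇒⋈ (guarded (inj₁ wy<wc))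
guarded-⋈ {wy , ly} {wc , lc} (inj₂ lc<ly) guarded with <-cmp wy wc
... | tri< wy<wc _ _ = SouthWest⇒⋈ (guarded (inj₁ wy<wc))
... | tri≈ _ w≡ _    = SouthWest⇒⋈ (guarded (inj₂ (w≡ , lc<ly)))
... | tri> _ _ wc<wy = inj₂ (lc<ly , wc<wy)

-- Good with children sorted by ≺ rather than lexicographically, condition (1) stated as compatibility
-- with the parent (equivalent by EdgeOK⇒⋈ and ⋈⇒EdgeOK), and inversions read along the postorder.
data Good≺ (p : Datum) : Tree → Set where
  good≺ : ∀ {w l cs} →
          1 ≤ w → 1 ≤ l → (w , l) ⋈ p →
          Linked _≺_ (map datum cs) →
          All (λ v → ¬ Inversion p (w , l) v) (postF cs) →
          All (Good≺ (w , l)) cs →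
          Good≺ p (node w l cs)

Forest≺ : Datum → List Tree → Set
Forest≺ p ts = Linked _≺_ (map datum ts) × All (Good≺ p) ts

-- The shape of postF (node c cs ∷ ts) under p, with xa = postF cs and xb = postF ts (rootSplit-postF);
-- by rootSplit-unique it determines c.
RootSplit : Datum → List Datum → Datum → List Datum → Set
RootSplit p xa c xb = c ⋈ p × All (¬_ ∘ Inversion p c) xa × All (λ v → v ⋈ p → c ≺ v) xb

rootSplit-above : ∀ {p u xa c xb} → u ≺ c → RootSplit p xa c xb →
                  All (λ v → v ⋈ p → u ≺ v) (xa ++ c ∷ xb)
rootSplit-above u≺c (_ , no-inv , above) =
  Allₚ.++⁺ (All.map (λ ni v⋈p → ≺-≮-trans u≺c (λ v≺c → ni (v⋈p , v≺c))) no-inv)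
           ((λ _ → u≺c) ∷ All.map (λ c≺v v⋈p → ≺-trans u≺c (c≺v v⋈p)) above)

postF-above : ∀ {p u ts} → Linked _≺_ (u ∷ map datum ts) → All (Good≺ p) ts →
              All (λ v → v ⋈ p → u ≺ v) (postF ts)
postF-above {ts = []}               _              []                                    = []
postF-above {ts = node w l cs ∷ ts} (u≺c ∷ sorted) (good≺ _ _ c⋈p _ no-inv _ ∷ goods) =
  rootSplit-above u≺c (c⋈p , no-inv , postF-above sorted goods)

rootSplit-postF : ∀ {p w l cs ts} → Forest≺ p (node w l cs ∷ ts) →
                  RootSplit p (postF cs) (w , l) (postF ts)
rootSplit-postF (sorted , good≺ _ _ c⋈p _ no-inv _ ∷ goods) = c⋈p , no-inv , postF-above sorted goods

postF-chain : ∀ {p ts} → Forest≺ p ts → All (Guarded p) (postF ts) → Linked Step↓ (postF ts ∷ʳ p)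
postF-chain {ts = []} _ _ = [-]
postF-chain {p} {node w l cs ∷ ts} (sorted , good≺ _ _ c⋈p sorted-cs no-inv goods-cs ∷ goods) guarded =
  subst (Linked Step↓) (sym (++-assoc (postF cs) ((w , l) ∷ postF ts) [ p ]))
    (Linked-join (postF cs) (postF-chain (sorted-cs , goods-cs) guarded-cs) c↓ts
                 (postF-chain (Linked.tail sorted , goods) guarded-ts))
  where
  guarded-cs : All (Guarded (w , l)) (postF cs)
  guarded-cs = All.zipWith (λ (ni , g) → guarded-child c⋈p ni g) (no-inv , Allₚ.++⁻ˡ (postF cs) guarded)
  guarded-ts : All (Guarded p) (postF ts)
  guarded-ts = All.tail (Allₚ.++⁻ʳ (postF cs) guarded)
  c↓ts : All (Step↓ (w , l)) (postF ts ∷ʳ p)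
  c↓ts = Allₚ.++⁺ (All.zipWith (λ (above , g) → guarded-step c⋈p above g)
                                (postF-above sorted goods , guarded-ts))
                  (⋈⇒Step↓ c⋈p ∷ [])

forest≺-Pos : ∀ {p ts} → All (Good≺ p) ts → All Pos (postF ts)
forest≺-Pos []                                        = []
forest≺-Pos (good≺ 1≤w 1≤l _ _ _ goods-cs ∷ goods) =
  Allₚ.++⁺ (forest≺-Pos goods-cs) ((1≤w , 1≤l) ∷ forest≺-Pos goods)

forest≺-Step↓ : ∀ {ts} → Forest≺ (0 , 0) ts → Linked Step↓ (postF ts)
forest≺-Step↓ {ts} forest =
  Linked-++⁻ˡ (postF ts) (postF-chain forest (All.map (guarded-root ∘ proj₁) (forest≺-Pos (proj₂ forest))))

good≺-⋈ : ∀ {p t} → Good≺ p t → datum t ⋈ p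
good≺-⋈ (good≺ _ _ t⋈p _ _ _) = t⋈p

postF-roots : ∀ {P : Datum → Set} ts → All P (postF ts) → All (P ∘ datum) ts
postF-roots []                 _  = []
postF-roots (node w l cs ∷ ts) ps with Allₚ.++⁻ʳ (postF cs) ps
... | pc ∷ pts = pc ∷ postF-roots ts pts

rootSplit-unique : ∀ {p c c′ xb xb′} xa xa′ → xa ++ c ∷ xb ≡ xa′ ++ c′ ∷ xb′ →
                   RootSplit p xa c xb → RootSplit p xa′ c′ xb′ → xa ≡ xa′ × c ≡ c′ × xb ≡ xb′
rootSplit-unique []       []         refl _ _ = refl , refl , refl
rootSplit-unique []       (_ ∷ xa′) refl (c⋈p , _ , above) (c′⋈p , ni ∷ _ , _) =
  contradiction (c⋈p , All.head (Allₚ.++⁻ʳ xa′ above) c′⋈p) ni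
rootSplit-unique (_ ∷ xa) []         refl (c⋈p , ni ∷ _ , _) (c′⋈p , _ , above′) =
  contradiction (c′⋈p , All.head (Allₚ.++⁻ʳ xa above′) c⋈p) ni
rootSplit-unique (_ ∷ xa) (_ ∷ xa′) eq (c⋈p , _ ∷ nis , above) (c′⋈p , _ ∷ nis′ , above′)
  with ∷-injective eq
... | refl , eq′ with rootSplit-unique xa xa′ eq′ (c⋈p , nis , above) (c′⋈p , nis′ , above′)
...   | refl , refl , refl = refl , refl , refl

postF-injective : ∀ {p ts ts′} → Forest≺ p ts → Forest≺ p ts′ → postF ts ≡ postF ts′ → ts ≡ ts′
postF-injective {ts = []} {[]} _ _ _ = refl
postF-injective {ts = []} {node _ _ cs′ ∷ _} _ _ eq =
  contradiction (++-conicalʳ (postF cs′) _ (sym eq)) λ ()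
postF-injective {ts = node _ _ cs ∷ _} {[]} _ _ eq =
  contradiction (++-conicalʳ (postF cs) _ eq) λ ()
postF-injective {ts = node w l cs ∷ ts} {node w′ l′ cs′ ∷ ts′}
                f@(sorted , good≺ _ _ _ sorted-cs _ goods-cs ∷ goods)
                f′@(sorted′ , good≺ _ _ _ sorted-cs′ _ goods-cs′ ∷ goods′) eq
  with rootSplit-unique (postF cs) (postF cs′) eq (rootSplit-postF f) (rootSplit-postF f′)
... | eq-cs , refl , eq-ts =
  cong₂ (λ cs ts → node w l cs ∷ ts)
    (postF-injective (sorted-cs , goods-cs) (sorted-cs′ , goods-cs′) eq-cs)
    (postF-injective (Linked.tail sorted , goods) (Linked.tail sorted′ , goods′) eq-ts)

record Decomposition (p : Datum) (s : List Datum) : Set where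
  constructor decomposition
  field
    before : List Datum
    root   : Datum
    after  : List Datum
    splits : s ≡ before ++ root ∷ after
    isRootSplit : RootSplit p before root after

-- Scanning from the right: x is the first root iff it is compatible with p and ≺ the first root of the rest.
decompose-∷ : ∀ {p} x xs → All (Guarded p) (x ∷ xs) → Linked Step↓ ((x ∷ xs) ∷ʳ p) →
              Decomposition p (x ∷ xs)
decompose-∷ x [] (guarded ∷ []) (x↓p ∷ [-]) = decomposition [] x [] refl (guarded-⋈ x↓p guarded , [] , [])
decompose-∷ {p} x (y ∷ ys) (_ ∷ guarded) (_ ∷ chain) with decompose-∷ y ys guarded chain
... | decomposition xa c xb eq split@(c⋈p , no-inv , above) with (x ⋈? p) ×-dec (x ≺? c)
...   | yes (x⋈p , x≺c) =
  decomposition [] x (y ∷ ys) refl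
    (x⋈p , [] , subst (All _) (sym eq) (rootSplit-above x≺c split))
...   | no ¬inv = decomposition (x ∷ xa) c xb (cong (x ∷_) eq) (c⋈p , ¬inv ∷ no-inv , above)

decompose : ∀ {p} s → All (Guarded p) s → Linked Step↓ (s ∷ʳ p) → s ≡ [] ⊎ Decomposition p s
decompose []       _       _     = inj₁ refl
decompose (x ∷ xs) guarded chain = inj₂ (decompose-∷ x xs guarded chain)

postF-surjective : ∀ {p} s → Acc _<_ (length s) →
                   All Pos s → All (Guarded p) s → Linked Step↓ (s ∷ʳ p) →
                   Σ[ ts ∈ List Tree ] Forest≺ p ts × postF ts ≡ s
postF-surjective s (acc smaller) pos guarded chain with decompose s guarded chain
... | inj₁ refl = [] , ([] , []) , refl
... | inj₂ (decomposition xa (w , l) xb refl (c⋈p , no-inv , above))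
  with postF-surjective xa (smaller (length-before< xa)) (Allₚ.++⁻ˡ xa pos) guarded-xa chain-xa
     | postF-surjective xb (smaller (length-after< xa)) (All.tail (Allₚ.++⁻ʳ xa pos))
                          (All.tail (Allₚ.++⁻ʳ xa guarded)) (Linked.tail (Linked-++⁻ʳ xa chain′))
  where
  chain′ : Linked Step↓ (xa ++ (w , l) ∷ (xb ∷ʳ _))
  chain′ = subst (Linked Step↓) (++-assoc xa ((w , l) ∷ xb) [ _ ]) chain
  chain-xa : Linked Step↓ (xa ∷ʳ (w , l))
  chain-xa =
    Linked-++⁻ˡ (xa ∷ʳ (w , l)) (subst (Linked Step↓) (sym (∷ʳ-++ xa (w , l) (xb ∷ʳ _))) chain′)
  guarded-xa : All (Guarded (w , l)) xa
  guarded-xa = All.zipWith (λ (ni , g) → guarded-child c⋈p ni g) (no-inv , Allₚ.++⁻ˡ xa guarded)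
... | cs , (sorted-cs , goods-cs) , refl | ts , (sorted-ts , goods-ts) , refl =
  node w l cs ∷ ts ,
  (Linked-∷⁺ (Allₚ.map⁺ c≺roots) sorted-ts , good≺ 1≤w 1≤l c⋈p sorted-cs no-inv goods-cs ∷ goods-ts) ,
  refl
  where
  c≺roots : All (λ t → (w , l) ≺ datum t) ts
  c≺roots = All.zipWith (λ (c≺ , g) → c≺ (good≺-⋈ g)) (postF-roots ts above , goods-ts)
  1≤w = proj₁ (All.head (Allₚ.++⁻ʳ xa pos))
  1≤l = proj₂ (All.head (Allₚ.++⁻ʳ xa pos))

GoodForest : Datum → List Tree → Set
GoodForest p ts = Linked _<lex_ (map datum ts) × All (Good p) ts

mutual
  good⇒good≺ : ∀ {p t} → Good p t → datum t ⋈ p → Good≺ p (Sort≺.resort t)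
  good⇒good≺ (good {cs = cs} 1≤w 1≤l edges sorted no-inv goods) t⋈p =
    good≺ 1≤w 1≤l t⋈p (Sort≺.resortForest-sorted (SortLex.sorted⇒distinct sorted))
      (All-resp-↭ (↭-sym (Sort≺.postF-resortForest cs)) no-inv)
      (All-resp-↭ (↭-sym (Sort≺.sort-↭ _)) (good⇒good≺-all (All.map EdgeOK⇒⋈ edges) goods))

  good⇒good≺-all : ∀ {p ts} → All (λ t → datum t ⋈ p) ts → All (Good p) ts →
                   All (Good≺ p) (Sort≺.resortAll ts)
  good⇒good≺-all []         []           = []
  good⇒good≺-all (t⋈p ∷ ps) (g ∷ goods) = good⇒good≺ g t⋈p ∷ good⇒good≺-all ps goods

mutual
  good≺⇒good : ∀ {p t} → Good≺ p t → Good p (SortLex.resort t)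
  good≺⇒good (good≺ {cs = cs} 1≤w 1≤l _ sorted no-inv goods) =
    good 1≤w 1≤l
      (All-resp-↭ (↭-sym (SortLex.sort-↭ _)) (edges goods))
      (SortLex.resortForest-sorted (Sort≺.sorted⇒distinct sorted))
      (All-resp-↭ (↭-sym (↭-trans (SortLex.vertsF-resortForest cs) (↭-sym (postF-↭-vertsF cs)))) no-inv)
      (All-resp-↭ (↭-sym (SortLex.sort-↭ _)) (good≺⇒good-all goods))
    where
    edges : ∀ {u ts} → All (Good≺ u) ts → All (EdgeOK u ∘ datum) (SortLex.resortAll ts)
    edges []                          = []
    edges (good≺ _ _ t⋈u _ _ _ ∷ gs) = ⋈⇒EdgeOK t⋈u ∷ edges gs

  good≺⇒good-all : ∀ {p ts} → All (Good≺ p) ts → All (Good p) (SortLex.resortAll ts)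
  good≺⇒good-all []          = []
  good≺⇒good-all (g ∷ goods) = good≺⇒good g ∷ good≺⇒good-all goods

mutual
  good⇒sortedTree : ∀ {p t} → Good p t → SortLex.SortedTree t
  good⇒sortedTree (good _ _ _ sorted _ goods) = SortLex.node sorted (good⇒sortedTree-all goods)

  good⇒sortedTree-all : ∀ {p ts} → All (Good p) ts → All SortLex.SortedTree ts
  good⇒sortedTree-all []          = []
  good⇒sortedTree-all (g ∷ goods) = good⇒sortedTree g ∷ good⇒sortedTree-all goods

mutual
  good≺⇒sortedTree : ∀ {p t} → Good≺ p t → Sort≺.SortedTree t
  good≺⇒sortedTree (good≺ _ _ _ sorted _ goods) = Sort≺.node sorted (good≺⇒sortedTree-all goods)

  good≺⇒sortedTree-all : ∀ {p ts} → All (Good≺ p) ts → All Sort≺.SortedTree ts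
  good≺⇒sortedTree-all []          = []
  good≺⇒sortedTree-all (g ∷ goods) = good≺⇒sortedTree g ∷ good≺⇒sortedTree-all goods

goodForest⇒forest≺ : ∀ {p ts} → All (λ t → datum t ⋈ p) ts → GoodForest p ts →
                     Forest≺ p (Sort≺.resortForest ts)
goodForest⇒forest≺ roots⋈p (sorted , goods) =
  Sort≺.resortForest-sorted (SortLex.sorted⇒distinct sorted) ,
  All-resp-↭ (↭-sym (Sort≺.sort-↭ _)) (good⇒good≺-all roots⋈p goods)

forest≺⇒goodForest : ∀ {p ts} → Forest≺ p ts → GoodForest p (SortLex.resortForest ts)
forest≺⇒goodForest (sorted , goods) =
  SortLex.resortForest-sorted (Sort≺.sorted⇒distinct sorted) ,
  All-resp-↭ (↭-sym (SortLex.sort-↭ _)) (good≺⇒good-all goods)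

resortForest-lex∘≺ : ∀ {p ts} → GoodForest p ts → SortLex.resortForest (Sort≺.resortForest ts) ≡ ts
resortForest-lex∘≺ (sorted , goods) =
  ResortInverse.resortForest-inverse (StrictTotalOrder.isStrictTotalOrder <lex-strictTotalOrder)
    (StrictTotalOrder.isStrictTotalOrder ≺-strictTotalOrder) sorted (good⇒sortedTree-all goods)

resortForest-≺∘lex : ∀ {p ts} → Forest≺ p ts → Sort≺.resortForest (SortLex.resortForest ts) ≡ ts
resortForest-≺∘lex (sorted , goods) =
  ResortInverse.resortForest-inverse (StrictTotalOrder.isStrictTotalOrder ≺-strictTotalOrder)
    (StrictTotalOrder.isStrictTotalOrder <lex-strictTotalOrder) sorted (good≺⇒sortedTree-all goods)

occ≡length-filter : ∀ i xs → occ i xs ≡ length (filter (_≟ i) xs)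
occ≡length-filter i []       = refl
occ≡length-filter i (x ∷ xs) with x ≟ i
... | yes x≡i = trans (cong suc (occ≡length-filter i xs)) (cong length (sym (filter-accept (_≟ i) x≡i)))
... | no x≢i  = trans (occ≡length-filter i xs) (cong length (sym (filter-reject (_≟ i) x≢i)))

occ-↭ : ∀ {xs ys} i → xs ↭ ys → occ i xs ≡ occ i ys
occ-↭ {xs} {ys} i p =
  trans (occ≡length-filter i xs) (trans (↭-length (filter-↭ (_≟ i) p)) (sym (occ≡length-filter i ys)))

occ-map : ∀ {f : ℕ → ℕ} {i j} bs → All (λ b → (f b ≡ i → b ≡ j) × (b ≡ j → f b ≡ i)) bs →
          occ i (map f bs) ≡ occ j bs
occ-map []       []                  = refl
occ-map {f} {i} {j} (b ∷ bs) ((to , from) ∷ hs) with f b ≟ i | b ≟ j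
... | yes _   | yes _   = cong suc (occ-map bs hs)
... | yes fb≡i | no b≢j = contradiction (to fb≡i) b≢j
... | no fb≢i | yes b≡j = contradiction (from b≡j) fb≢i
... | no _    | no _    = occ-map bs hs

occ-map-∉ : ∀ {f : ℕ → ℕ} {i} bs → All (λ b → f b ≢ i) bs → occ i (map f bs) ≡ 0
occ-map-∉ []       []         = refl
occ-map-∉ {f} {i} (b ∷ bs) (fb≢i ∷ hs) with f b ≟ i
... | yes fb≡i = contradiction fb≡i fb≢i
... | no _     = occ-map-∉ bs hs

occ≢0⇒∈ : ∀ {j} bs → occ j bs ≢ 0 → j ∈ bs
occ≢0⇒∈ []       occ≢0 = contradiction refl occ≢0
occ≢0⇒∈ {j} (b ∷ bs) occ≢0 with b ≟ j
... | yes b≡j = here (sym b≡j)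
... | no _    = there (occ≢0⇒∈ bs occ≢0)

∈⇒occ≢0 : ∀ {j bs} → j ∈ bs → occ j bs ≢ 0
∈⇒occ≢0 {j} {b ∷ bs} j∈ with b ≟ j | j∈
... | yes _   | _          = λ ()
... | no b≢j  | here j≡b   = contradiction (sym j≡b) b≢j
... | no _    | there j∈bs = ∈⇒occ≢0 j∈bs

lo hi : List ℕ → ℕ
lo []       = 0
lo (b ∷ bs) = min b bs
hi []       = 0
hi (b ∷ bs) = max b bs

lo≤ : ∀ L → All (lo L ≤_) L
lo≤ []       = []
lo≤ (b ∷ bs) = min≤⊤ b bs ∷ min≤xs b bs

≤hi : ∀ L → All (_≤ hi L) L
≤hi []       = []
≤hi (b ∷ bs) = ⊥≤max b bs ∷ xs≤max b bs

lo∈ : ∀ b bs → lo (b ∷ bs) ∈ b ∷ bs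
lo∈ b bs with argmin-sel id b bs
... | inj₁ min≡b  = here min≡b
... | inj₂ min∈bs = there min∈bs

hi∈ : ∀ b bs → hi (b ∷ bs) ∈ b ∷ bs
hi∈ b bs with argmax-sel id b bs
... | inj₁ max≡b  = here max≡b
... | inj₂ max∈bs = there max∈bs

lo-unique : ∀ {m} L → m ∈ L → All (m ≤_) L → lo L ≡ m
lo-unique (b ∷ bs) m∈ (m≤b ∷ m≤bs) = ≤-antisym (min≤v⁺ b bs (witness m∈)) (v≤min⁺ m≤b m≤bs)
  where
  witness : ∀ {m} → m ∈ b ∷ bs → b ≤ m ⊎ Any (_≤ m) bs
  witness (here m≡b)   = inj₁ (≤-reflexive (sym m≡b))
  witness (there m∈bs) = inj₂ (Any.map (≤-reflexive ∘ sym) m∈bs)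

hi-unique : ∀ {m} L → m ∈ L → All (_≤ m) L → hi L ≡ m
hi-unique (b ∷ bs) m∈ (b≤m ∷ bs≤m) = ≤-antisym (max≤v⁺ b≤m bs≤m) (v≤max⁺ b bs (witness m∈))
  where
  witness : ∀ {m} → m ∈ b ∷ bs → m ≤ b ⊎ Any (m ≤_) bs
  witness (here m≡b)   = inj₁ (≤-reflexive m≡b)
  witness (there m∈bs) = inj₂ (Any.map ≤-reflexive m∈bs)

m≤m+n∸o : ∀ m {n o} → o ≤ n → m ≤ m + n ∸ o
m≤m+n∸o m {n} {o} o≤n = subst (_≤ m + n ∸ o) (m+n∸n≡m m n) (∸-monoʳ-≤ (m + n) o≤n)

m+n∸o≤n : ∀ {m} n {o} → m ≤ o → m + n ∸ o ≤ n
m+n∸o≤n {m} n {o} m≤o = subst (m + n ∸ o ≤_) (m+n∸m≡n m n) (∸-monoʳ-≤ (m + n) m≤o)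

axis : List ℕ → ℕ
axis L = lo L + hi L

reflectLevels : List ℕ → List ℕ
reflectLevels L = map (axis L ∸_) L

≤axis : ∀ L → All (_≤ axis L) L
≤axis L = All.map (λ b≤hi → ≤-trans b≤hi (m≤n+m (hi L) (lo L))) (≤hi L)

axis-reflectLevels : ∀ L → axis (reflectLevels L) ≡ axis L
axis-reflectLevels []          = refl
axis-reflectLevels L@(b ∷ bs) = cong₂ _+_ lo-reflect hi-reflect
  where
  lo∈reflect : lo L ∈ reflectLevels L
  lo∈reflect = subst (_∈ reflectLevels L) (m+n∸n≡m (lo L) (hi L)) (∈-map⁺ (axis L ∸_) (hi∈ b bs))
  hi∈reflect : hi L ∈ reflectLevels L
  hi∈reflect = subst (_∈ reflectLevels L) (m+n∸m≡n (lo L) (hi L)) (∈-map⁺ (axis L ∸_) (lo∈ b bs))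
  lo-reflect : lo (reflectLevels L) ≡ lo L
  lo-reflect = lo-unique (reflectLevels L) lo∈reflect (Allₚ.map⁺ (All.map (m≤m+n∸o (lo L)) (≤hi L)))
  hi-reflect : hi (reflectLevels L) ≡ hi L
  hi-reflect = hi-unique (reflectLevels L) hi∈reflect (Allₚ.map⁺ (All.map (m+n∸o≤n (hi L)) (lo≤ L)))

occ-reflectLevels : ∀ {S M} L → All (λ b → S ≤ b × b ≤ M) L → ∀ i →
                    occ i (map (S + M ∸_) L) ≡ revAt (λ j → occ j L) S M i
occ-reflectLevels {S} {M} L bounds i with S ≤? i | i ≤? M
... | yes _   | yes i≤M = occ-map L (All.map (λ (_ , b≤M) → to b≤M , from) bounds)
  where
  to : ∀ {b} → b ≤ M → S + M ∸ b ≡ i → b ≡ S + M ∸ i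
  to b≤M K∸b≡i = trans (sym (m∸[m∸n]≡n (≤-trans b≤M (m≤n+m M S)))) (cong (S + M ∸_) K∸b≡i)
  from : ∀ {b} → b ≡ S + M ∸ i → S + M ∸ b ≡ i
  from b≡K∸i = trans (cong (S + M ∸_) b≡K∸i) (m∸[m∸n]≡n (≤-trans i≤M (m≤n+m M S)))
... | no S≰i  | _       =
  occ-map-∉ L (All.map (λ (_ , b≤M) K∸b≡i → S≰i (subst (S ≤_) K∸b≡i (m≤m+n∸o S b≤M))) bounds)
... | yes _   | no i≰M  =
  occ-map-∉ L (All.map (λ (S≤b , _) K∸b≡i → i≰M (subst (_≤ M) K∸b≡i (m+n∸o≤n M S≤b))) bounds)

revAt-cong : ∀ {β β′} → (∀ j → β j ≡ β′ j) → ∀ s m i → revAt β s m i ≡ revAt β′ s m i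
revAt-cong β≗β′ s m i =
  cong (λ x → if ⌊ s ≤? i ⌋ ∧ ⌊ i ≤? m ⌋ then x else 0) (β≗β′ (s + m ∸ i))

reflectLevels-IsRev : ∀ {β} L → All (1 ≤_) L → (∀ j → β j ≡ occ j L) →
                      IsRev β (λ j → occ j (reflectLevels L))
reflectLevels-IsRev {β} L positive β≗ S M (_ , βS≢0 , below) (_ , βM≢0 , above) i _ = begin
  occ i (map (lo L + hi L ∸_) L)  ≡⟨ cong₂ (λ s m → occ i (map (s + m ∸_) L)) lo≡S hi≡M ⟩
  occ i (map (S + M ∸_) L)        ≡⟨ occ-reflectLevels L (All.zipWith id (S≤L , L≤M)) i ⟩
  revAt (λ j → occ j L) S M i     ≡⟨ revAt-cong (sym ∘ β≗) S M i ⟩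
  revAt β S M i                   ∎
  where
  open ≡-Reasoning
  occ≢0 : ∀ {b} → b ∈ L → β b ≢ 0
  occ≢0 b∈L βb≡0 = ∈⇒occ≢0 b∈L (trans (sym (β≗ _)) βb≡0)
  S≤L : All (S ≤_) L
  S≤L = All.tabulate (λ b∈L → ≮⇒≥ (λ b<S → occ≢0 b∈L (below _ (All.lookup positive b∈L) b<S)))
  L≤M : All (_≤ M) L
  L≤M = All.tabulate (λ b∈L → ≮⇒≥ (λ M<b → occ≢0 b∈L (above _ M<b)))
  lo≡S : lo L ≡ S
  lo≡S = lo-unique L (occ≢0⇒∈ L (βS≢0 ∘ trans (β≗ S))) S≤L
  hi≡M : hi L ≡ M
  hi≡M = hi-unique L (occ≢0⇒∈ L (βM≢0 ∘ trans (β≗ M))) L≤M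

levels : List Datum → List ℕ
levels = map lvOf

reflect : List Datum → List Datum
reflect s = map (map₂ (axis (levels s) ∸_)) s

labels-reflect : ∀ s → map wOf (reflect s) ≡ map wOf s
labels-reflect s = sym (map-∘ s)

levels-reflect : ∀ s → levels (reflect s) ≡ reflectLevels (levels s)
levels-reflect s = trans (sym (map-∘ s)) (map-∘ s)

levels≤axis : ∀ s → All (λ x → lvOf x ≤ axis (levels s)) s
levels≤axis s = Allₚ.map⁻ (≤axis (levels s))

reflect-involutive : ∀ s → reflect (reflect s) ≡ s
reflect-involutive s = begin
  map (map₂ (axis (levels (reflect s)) ∸_)) (reflect s)
    ≡⟨ cong (λ K → map (map₂ (K ∸_)) (reflect s)) axis-eq ⟩
  map (map₂ (K ∸_)) (map (map₂ (K ∸_)) s)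
    ≡⟨ sym (map-∘ s) ⟩
  map (map₂ (K ∸_) ∘ map₂ (K ∸_)) s
    ≡⟨ map-id-local (All.map (λ {x} l≤K → cong (proj₁ x ,_) (m∸[m∸n]≡n l≤K)) (levels≤axis s)) ⟩
  s ∎
  where
  open ≡-Reasoning
  K = axis (levels s)
  axis-eq : axis (levels (reflect s)) ≡ K
  axis-eq = trans (cong axis (levels-reflect s)) (axis-reflectLevels (levels s))

reflect-Step↓ : ∀ {s} → Linked Step↓ s → Linked Step (reflect s)
reflect-Step↓ {s} = Linked-map-local step (levels≤axis s)
  where
  step : ∀ {x y} → lvOf x ≤ axis (levels s) → lvOf y ≤ axis (levels s) → Step↓ x y → Step _ _
  step _    _ (inj₁ wx<wy) = inj₁ wx<wy
  step lx≤K _ (inj₂ ly<lx) = inj₂ (∸-monoʳ-< ly<lx lx≤K)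

reflect-Step : ∀ {r} → Linked Step r → Linked Step↓ (reflect r)
reflect-Step {r} = Linked-map-local step (levels≤axis r)
  where
  step : ∀ {x y} → lvOf x ≤ axis (levels r) → lvOf y ≤ axis (levels r) → Step x y → Step↓ _ _
  step _ _    (inj₁ wx<wy) = inj₁ wx<wy
  step _ ly≤K (inj₂ lx<ly) = inj₂ (∸-monoʳ-< lx<ly ly≤K)

reflect-Pos : ∀ {s} → All Pos s → All Pos (reflect s)
reflect-Pos {[]}    []  = []
reflect-Pos {x ∷ s} pos =
  Allₚ.map⁺ (All.zipWith (λ ((1≤w , _) , l≤hi) → 1≤w , ≤-trans 1≤lo (m≤m+n∸o (lo L) l≤hi))
                         (pos , Allₚ.map⁻ (≤hi L)))
  where
  L = levels (x ∷ s)
  1≤lo : 1 ≤ lo L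
  1≤lo = All.lookup (Allₚ.map⁺ (All.map proj₂ pos)) (lo∈ (lvOf x) (levels s))

-- Pads with (0 , 0) or truncates; only ever applied to lists of length n.
toVec : ∀ n → List Datum → Vec Datum n
toVec zero    _        = []
toVec (suc n) []       = (0 , 0) ∷ toVec n []
toVec (suc n) (x ∷ xs) = x ∷ toVec n xs

toList∘toVec : ∀ {n} xs → length xs ≡ n → toList (toVec n xs) ≡ xs
toList∘toVec []       refl = refl
toList∘toVec (x ∷ xs) refl = cong (x ∷_) (toList∘toVec xs refl)

toVec∘toList : ∀ {n} (v : Vec Datum n) → toVec n (toList v) ≡ v
toVec∘toList []      = refl
toVec∘toList (x ∷ v) = cong (x ∷_) (toVec∘toList v)

zip-map-proj : ∀ {n} (v : Vec Datum n) → zip (Vec.map proj₁ v) (Vec.map proj₂ v) ≡ v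
zip-map-proj []      = refl
zip-map-proj (x ∷ v) = cong (x ∷_) (zip-map-proj v)

vecs : ∀ n → List Datum → Vec ℕ n × Vec ℕ n
vecs n r = Vec.map proj₁ (toVec n r) , Vec.map proj₂ (toVec n r)

pairs : ∀ {n} → Vec ℕ n × Vec ℕ n → List Datum
pairs (a , b) = toList (zip a b)

pairs∘vecs : ∀ {n} r → length r ≡ n → pairs (vecs n r) ≡ r
pairs∘vecs {n} r len = trans (cong toList (zip-map-proj (toVec n r))) (toList∘toVec r len)

vecs∘pairs : ∀ {n} (ab : Vec ℕ n × Vec ℕ n) → vecs n (pairs ab) ≡ ab
vecs∘pairs (a , b) rewrite toVec∘toList (zip a b) = cong₂ _,_ (map-proj₁-zip a b) (map-proj₂-zip a b)

labels-vecs : ∀ {n} r → length r ≡ n → toList (proj₁ (vecs n r)) ≡ map wOf r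
labels-vecs {n} r len = trans (toList-map proj₁ (toVec n r)) (cong (map proj₁) (toList∘toVec r len))

levels-vecs : ∀ {n} r → length r ≡ n → toList (proj₂ (vecs n r)) ≡ map lvOf r
levels-vecs {n} r len = trans (toList-map proj₂ (toVec n r)) (cong (map proj₂) (toList∘toVec r len))

labels-pairs : ∀ {n} (ab : Vec ℕ n × Vec ℕ n) → map wOf (pairs ab) ≡ toList (proj₁ ab)
labels-pairs (a , b) =
  trans (sym (labels-vecs (pairs (a , b)) (length-toList (zip a b))))
        (cong (toList ∘ proj₁) (vecs∘pairs (a , b)))

levels-pairs : ∀ {n} (ab : Vec ℕ n × Vec ℕ n) → map lvOf (pairs ab) ≡ toList (proj₂ ab)
levels-pairs (a , b) =
  trans (sym (levels-vecs (pairs (a , b)) (length-toList (zip a b))))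
        (cong (toList ∘ proj₂) (vecs∘pairs (a , b)))

good-⋈root : ∀ {p t} → Good p t → datum t ⋈ (0 , 0)
good-⋈root (good 1≤w 1≤l _ _ _ _) = inj₂ (1≤l , 1≤w)

resortForest-forest≺ : ∀ {ts} → GoodRooted ts → Forest≺ (0 , 0) (Sort≺.resortForest ts)
resortForest-forest≺ good-ts@(_ , goods) = goodForest⇒forest≺ (All.map good-⋈root goods) good-ts

code : List Tree → List Datum
code ts = reflect (postF (Sort≺.resortForest ts))

length-code : ∀ ts → length (code ts) ≡ length (vertsF ts)
length-code ts = trans (length-map _ (postF (Sort≺.resortForest ts))) (↭-length (Sort≺.postF-resortForest ts))

labels-code : ∀ ts → map wOf (code ts) ↭ map wOf (vertsF ts)
labels-code ts =
  subst (_↭ map wOf (vertsF ts)) (sym (labels-reflect _)) (Perm.map⁺ wOf (Sort≺.postF-resortForest ts))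

code-Pos : ∀ {ts} → GoodRooted ts → All Pos (code ts)
code-Pos good-ts = reflect-Pos (forest≺-Pos (proj₂ (resortForest-forest≺ good-ts)))

code-Step : ∀ {ts} → GoodRooted ts → Linked Step (code ts)
code-Step good-ts = reflect-Step↓ (forest≺-Step↓ (resortForest-forest≺ good-ts))

code-injective : ∀ {ts ts′} → GoodRooted ts → GoodRooted ts′ → code ts ≡ code ts′ → ts ≡ ts′
code-injective {ts} {ts′} good-ts good-ts′ eq = begin
  ts                                              ≡⟨ sym (resortForest-lex∘≺ good-ts) ⟩
  SortLex.resortForest (Sort≺.resortForest ts)    ≡⟨ cong SortLex.resortForest forest-eq ⟩
  SortLex.resortForest (Sort≺.resortForest ts′)   ≡⟨ resortForest-lex∘≺ good-ts′ ⟩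
  ts′                                             ∎
  where
  open ≡-Reasoning
  forest-eq : Sort≺.resortForest ts ≡ Sort≺.resortForest ts′
  forest-eq = postF-injective (resortForest-forest≺ good-ts) (resortForest-forest≺ good-ts′)
    (trans (sym (reflect-involutive _)) (trans (cong reflect eq) (reflect-involutive _)))

code-surjective : ∀ r → All Pos r → Linked Step r → Σ[ ts ∈ List Tree ] GoodRooted ts × code ts ≡ r
code-surjective r pos chain
  with postF-surjective (reflect r) (<-wellFounded _) pos↓ (All.map (guarded-root ∘ proj₁) pos↓)
         (Linked-∷ʳ⁺ (reflect-Step chain) (All.map (λ (_ , 1≤l) → inj₂ 1≤l) pos↓))
  where
  pos↓ = reflect-Pos pos
... | F , forest , postF-F≡ = SortLex.resortForest F , forest≺⇒goodForest forest , (begin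
  reflect (postF (Sort≺.resortForest (SortLex.resortForest F)))
    ≡⟨ cong (reflect ∘ postF) (resortForest-≺∘lex forest) ⟩
  reflect (postF F)    ≡⟨ cong reflect postF-F≡ ⟩
  reflect (reflect r)  ≡⟨ reflect-involutive r ⟩
  r                    ∎)
  where open ≡-Reasoning

module _ (n : ℕ) where

  length-code≡n : (T : ZRTT₀ n) → length (code (proj₁ T)) ≡ n
  length-code≡n (ts , len , _) = trans (length-code ts) len

  encode : ZRTT₀ n → ZLD² n
  encode T@(ts , _ , good-ts) =
    vecs n (code ts) ,
    subst (All (1 ≤_)) (sym (labels-vecs (code ts) len)) (Allₚ.map⁺ (All.map proj₁ (code-Pos good-ts))) ,
    subst (All (1 ≤_)) (sym (levels-vecs (code ts) len)) (Allₚ.map⁺ (All.map proj₂ (code-Pos good-ts))) ,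
    subst (Linked Step) (sym (pairs∘vecs (code ts) len)) (code-Step good-ts)
    where
    len = length-code≡n T

  encode-injective : ∀ {T T′} → proj₁ (encode T) ≡ proj₁ (encode T′) → proj₁ T ≡ proj₁ T′
  encode-injective {T@(ts , _ , good-ts)} {T′@(ts′ , _ , good-ts′)} eq =
    code-injective good-ts good-ts′ (begin
      code ts                    ≡⟨ sym (pairs∘vecs (code ts) (length-code≡n T)) ⟩
      pairs (vecs n (code ts))   ≡⟨ cong pairs eq ⟩
      pairs (vecs n (code ts′))  ≡⟨ pairs∘vecs (code ts′) (length-code≡n T′) ⟩
      code ts′                   ∎)
    where open ≡-Reasoning

  encode-surjective : ∀ (y : ZLD² n) → Σ[ T ∈ ZRTT₀ n ] proj₁ (encode T) ≡ proj₁ y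
  encode-surjective (ab@(a , b) , 1≤a , 1≤b , chain) with code-surjective (pairs ab) pos chain
    where
    pos : All Pos (pairs ab)
    pos = All.zip ( Allₚ.map⁻ (subst (All (1 ≤_)) (sym (labels-pairs ab)) 1≤a)
                  , Allₚ.map⁻ (subst (All (1 ≤_)) (sym (levels-pairs ab)) 1≤b))
  ... | ts , good-ts , code≡ =
    (ts , trans (sym (length-code ts)) (trans (cong length code≡) (length-toList (zip a b))) , good-ts) ,
    trans (cong (vecs n) code≡) (vecs∘pairs ab)

  bijection : Bijection (ZRTT₀-setoid n) (ZLD²-setoid n)
  bijection = record
    { to        = encode
    ; cong      = λ T≈T′ → cong (vecs n ∘ code) T≈T′
    ; bijective = (λ {T} {T′} → encode-injective {T} {T′}) , surjective
    }
    where
    surjective : ∀ y → Σ[ T ∈ ZRTT₀ n ] (∀ {T′} → proj₁ T′ ≡ proj₁ T → proj₁ (encode T′) ≡ proj₁ y)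
    surjective y with encode-surjective y
    ... | T , encode-T≡y = T , λ T′≈T → trans (cong (vecs n ∘ code) T′≈T) encode-T≡y

  encode-labels : ∀ T i → αD (encode T) i ≡ αT T i
  encode-labels T@(ts , _ , _) i =
    trans (cong (occ i) (labels-vecs (code ts) (length-code≡n T))) (occ-↭ i (labels-code ts))

  encode-levels : ∀ T → IsRev (βT T) (βD (encode T))
  encode-levels T@(ts , _ , good-ts) S M min-S max-M i 1≤i =
    trans (cong (occ i) (trans (levels-vecs (code ts) (length-code≡n T)) (levels-reflect s)))
          (reflectLevels-IsRev (levels s) positive β≗ S M min-S max-M i 1≤i)
    where
    s = postF (Sort≺.resortForest ts)
    positive : All (1 ≤_) (levels s)
    positive = Allₚ.map⁺ (All.map proj₂ (forest≺-Pos (proj₂ (resortForest-forest≺ good-ts))))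
    β≗ : ∀ j → occ j (levels (vertsF ts)) ≡ occ j (levels s)
    β≗ j = sym (occ-↭ j (Perm.map⁺ lvOf (Sort≺.postF-resortForest ts)))

theorem4p1 : (n : ℕ) → 1 ≤ n →
    Σ (Bijection (ZRTT₀-setoid n) (ZLD²-setoid n)) λ φ →
      (T : ZRTT₀ n) →
        ((i : ℕ) → 1 ≤ i → αD (Bijection.to φ T) i ≡ αT T i)
        × IsRev (βT T) (βD (Bijection.to φ T))
theorem4p1 n _ = bijection n , λ T → (λ i _ → encode-labels n T i) , encode-levels n T
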